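{- (Weak transitivity) For all $\alpha,\beta,\gamma\in For$: if $\{\alpha\}\vDash^{\mathbb{P}}_{K_3}\beta$ and $\{\beta\}\vDash^{\mathbb{P}}_{K_3}\gamma$, then $\{\alpha\}\vDash^{\mathbb{P}}_{K_3}\gamma$.
   Context: $For$ is the set of formulas built from a countable set $Prop$ of propositional letters with $\neg,\vee,\wedge,\rightarrow$. $K_3$ (Kleene) is given by the matrix with truth values $\{0,1/2,1\}$, designated set $\{1\}$, $f_\neg(x)=1-x$, $f_\vee=\max$, $f_\wedge=\min$, $f_\rightarrow(x,y)=\max\{1-x,y\}$; valuations are maps $Prop\to\{0,1/2,1\}$ extended via these functions. $\Gamma\vDash_{K_3}\alpha$ iff every valuation giving all members of $\Gamma$ value $1$ gives $\alpha$ value $1$; $\Gamma$ is $K_3$-consistent iff $\{\alpha:\Gamma\vDash_{K_3}\alpha\}\neq For$. $\Gamma\vDash^{\mathbb{P}}_{K_3}\alpha$ iff there exists a $K_3$-consistent $\Gamma'\subseteq\Gamma$ with $\Gamma'\vDash_{K_3}\alpha$. -}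

module Defs where

open import Data.Nat using (ℕ)
open import Data.Product using (Σ; ∃; _×_)
open import Relation.Binary.PropositionalEquality using (_≡_)
open import Relation.Nullary using (¬_)
open import Level using (0ℓ)

Prop : Set
Prop = ℕ

infixr 5 _⇒_
infixr 6 _∨_
infixr 7 _∧_
data For : Set where
  var : Prop → For
  ¬′_ : For → For
  _∨_ : For → For → For
  _∧_ : For → For → For
  _⇒_ : For → For → For

-- Truth values {0, 1/2, 1}
data V3 : Set where
  v0 vh v1 : V3

f¬ : V3 → V3
f¬ v0 = v1
f¬ vh = vh
f¬ v1 = v0

f∨ : V3 → V3 → V3
f∨ v0 y = y
f∨ vh v0 = vh
f∨ vh vh = vh
f∨ vh v1 = v1
f∨ v1 y = v1

f∧ : V3 → V3 → V3
f∧ v0 y = v0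
f∧ vh v0 = v0
f∧ vh vh = vh
f∧ vh v1 = vh
f∧ v1 y = y

f⇒ : V3 → V3 → V3
f⇒ x y = f∨ (f¬ x) y

Valuation : Set
Valuation = Prop → V3

⟦_⟧ : For → Valuation → V3
⟦ var p ⟧ v = v p
⟦ ¬′ a ⟧ v = f¬ (⟦ a ⟧ v)
⟦ a ∨ b ⟧ v = f∨ (⟦ a ⟧ v) (⟦ b ⟧ v)
⟦ a ∧ b ⟧ v = f∧ (⟦ a ⟧ v) (⟦ b ⟧ v)
⟦ a ⇒ b ⟧ v = f⇒ (⟦ a ⟧ v) (⟦ b ⟧ v)

FSet : Set₁
FSet = For → Set

_⊆_ : FSet → FSet → Set
Γ ⊆ Δ = ∀ φ → Γ φ → Δ φ

｛_｝ : For → FSet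
｛ α ｝ φ = φ ≡ α

_⊨K3_ : FSet → For → Set
Γ ⊨K3 α = (v : Valuation) → (∀ φ → Γ φ → ⟦ φ ⟧ v ≡ v1) → ⟦ α ⟧ v ≡ v1

K3-consistent : FSet → Set
K3-consistent Γ = ∃ λ φ → ¬ (Γ ⊨K3 φ)

_⊨P_ : FSet → For → Set₁
Γ ⊨P α = Σ FSet λ Γ′ → (Γ′ ⊆ Γ) × K3-consistent Γ′ × (Γ′ ⊨K3 α)

{-# OPTIONS --safe #-}
module Submission where

open import Defs
open import Data.Product using (_,_)
open import Relation.Binary.PropositionalEquality using (sym; subst)

-- The witness for Γ ⊨P γ is the consistent Γ′ ⊆ Γ that witnesses Γ ⊨P β:
-- whatever part of ｛ β ｝ is used to derive γ, Γ′ already derives all of it.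

_⊨K3-all_ : FSet → FSet → Set
Γ ⊨K3-all Δ = ∀ φ → Δ φ → Γ ⊨K3 φ

⊨K3-trans : ∀ {Γ Δ γ} → Γ ⊨K3-all Δ → Δ ⊨K3 γ → Γ ⊨K3 γ
⊨K3-trans Γ⊨Δ Δ⊨γ v v⊨Γ = Δ⊨γ v (λ φ Δφ → Γ⊨Δ φ Δφ v v⊨Γ)

⊨K3-all-⊆｛｝ : ∀ {Γ Δ β} → Δ ⊆ ｛ β ｝ → Γ ⊨K3 β → Γ ⊨K3-all Δ
⊨K3-all-⊆｛｝ {Γ} Δ⊆β Γ⊨β φ Δφ = subst (Γ ⊨K3_) (sym (Δ⊆β φ Δφ)) Γ⊨β

⊨P-trans-｛｝ : ∀ {Γ β γ} → Γ ⊨P β → ｛ β ｝ ⊨P γ → Γ ⊨P γ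
⊨P-trans-｛｝ {γ = γ} (Γ′ , Γ′⊆Γ , Γ′-con , Γ′⊨β) (Δ′ , Δ′⊆β , _ , Δ′⊨γ) =
  Γ′ , Γ′⊆Γ , Γ′-con , ⊨K3-trans {γ = γ} (⊨K3-all-⊆｛｝ Δ′⊆β Γ′⊨β) Δ′⊨γ

proposition27 : (α β γ : For) → ｛ α ｝ ⊨P β → ｛ β ｝ ⊨P γ → ｛ α ｝ ⊨P γ
proposition27 α β γ = ⊨P-trans-｛｝ {γ = γ}
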